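{- For every sequence $v$, the function $ss(m,v)$ is quasilinear in $m^{1/2}$; that is, there exists a constant $t$ (depending on $v$) such that $ss(m,v) = O\big(m^{1/2}(\log m)^t\big)$ as $m \to \infty$.
   Context: Sequences are finite words over an arbitrary alphabet. Two sequences are isomorphic if one can be obtained from the other by a bijective renaming of letters. A sequence $u$ is $v$-free if no subsequence of $u$ is isomorphic to $v$. For sequences $u, v$, $LSS(u,v)$ is the maximum length of a $v$-free subsequence of $u$, and $ss(m,v)$ is the minimum of $LSS(u,v)$ over all sequences $u$ of length $m$. A function $f(n)$ is called quasilinear if there exists a constant $t$ with $f(n) = O(n\log(n)^t)$; "quasilinear in $m^{1/2}$" means $O(m^{1/2}\log(m)^t)$ for some constant $t$. -}

module Defs where

open import Data.Nat using (ℕ; _≤_)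
open import Data.List using (List; length; map)
open import Data.List.Membership.Propositional using (_∈_)
open import Data.List.Relation.Binary.Sublist.Propositional using (_⊆_)
open import Data.Product using (∃-syntax; _×_)
open import Relation.Binary.PropositionalEquality using (_≡_)
open import Relation.Nullary using (¬_)

-- Sequences are finite words; letters are drawn from ℕ (any finite word over
-- any alphabet is isomorphic to one over ℕ, and all notions are isomorphism-invariant).
Seq : Set
Seq = List ℕ

-- w and v are isomorphic: v is obtained from w by a renaming f of letters
-- that is injective on the letters of w (hence a bijection onto the letters of v).
Isomorphic : Seq → Seq → Set
Isomorphic w v = ∃[ f ] (map f w ≡ v × (∀ x y → x ∈ w → y ∈ w → f x ≡ f y → x ≡ y))

Free : Seq → Seq → Set
Free u v = ¬ (∃[ w ] (w ⊆ u × Isomorphic w v))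

LSS≤ : Seq → Seq → ℕ → Set
LSS≤ u v B = ∀ w → w ⊆ u → Free w v → length w ≤ B

-- ss(m,v) ≤ B : some sequence u of length m has LSS(u,v) ≤ B
-- (ss(m,v) is the minimum of LSS(u,v) over |u| = m).
ss≤ : ℕ → Seq → ℕ → Set
ss≤ m v B = ∃[ u ] (length u ≡ m × LSS≤ u v B)

module Submission where

-- Witness: for k = 2^j with m ≤ k² ≤ 4m, the first m letters u of (k-1 ⋯ 1 0)^k.  Every
-- subsequence w of u is a k-block sequence: a concatenation of k sublists ("blocks") of the
-- repetition-free alphabet A = (k-1 ⋯ 0); and w uses at most k letters.
-- An (N,n)-formation in w is a set S of N distinct letters with a splitting of w into n
-- consecutive segments each containing all of S.  Any v of length N embeds, up to renaming,
-- into an (N,N)-formation, so a v-free w has none (formation⇒¬free).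
-- Formation lemma (FormationLemma.bound): a block sequence with K ≤ 2^h blocks, using r letters
-- and containing no (N,n)-formation, has length ≤ 2^n (N+1) (r + K) (h+1)^n.  By induction on n
-- and h: halve the blocks as x ++ y; letters private to one half are bounded at level (n,h),
-- letters shared by both halves at level (n-1,h), as a formation among them gains a round from
-- the other half.  With n = N, h = j, r ≤ k this bounds LSS(u,v), and j + 1 ≤ ⌊log₂ m⌋ gives the
-- theorem.

open import Defs
open import Data.Nat using (ℕ; zero; suc; _≤_; _<_; _+_; _*_; _^_; _∸_; _≟_; _≤?_; z≤n; s≤s)
open import Data.Nat.Tactic.RingSolver using (solve-∀)
open import Data.Nat.Logarithm using (⌊log₂_⌋; ⌊log₂⌋-mono-≤; ⌊log₂[2^n]⌋≡n)
open import Data.Nat.Properties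
open import Data.Empty using (⊥; ⊥-elim)
open import Data.Product using (∃-syntax; _×_; _,_; proj₁; proj₂)
open import Data.List using (List; []; _∷_; _++_; length; map; concat; replicate; take; filter; downFrom)
open import Data.List.Properties
  using (length-++; length-take; length-downFrom; length-map; ++-assoc; ++-identityʳ; length-filter; filter-all; filter-++; map-∘; map-id-local)
open import Data.List.Membership.Propositional using (_∈_)
open import Data.List.Membership.Propositional.Properties using (∈-++⁺ˡ; ∈-++⁺ʳ; ∈-filter⁻; ∈-map⁻)
open import Data.List.Membership.DecPropositional _≟_ using (_∈?_)
open import Data.List.Relation.Unary.All as All using (All; []; _∷_)
open import Data.List.Relation.Unary.All.Properties as All using ()
open import Data.List.Relation.Unary.Any using (here; there)
open import Data.List.Relation.Unary.Unique.Propositional using (Unique)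
open import Data.List.Relation.Unary.Unique.Propositional.Properties using (downFrom⁺; take⁺) renaming (filter⁺ to unique-filter⁺)
open import Data.List.Relation.Unary.AllPairs using (_∷_)
open import Data.List.Relation.Binary.Sublist.Propositional
  using (_⊆_; []; _∷_; _∷ʳ_; ⊆-refl; ⊆-trans; lookup; minimum; from∈)
open import Data.List.Relation.Binary.Sublist.Propositional.Properties
  using (length-mono-≤; filter-⊆; filter⁺; ++⁺; ++⁺ˡ; ++⁺ʳ; take-⊆)
open import Relation.Binary.PropositionalEquality using (_≡_; refl; sym; trans; cong; cong₂; subst; module ≡-Reasoning)
open import Function using (_∘_)
open import Relation.Nullary using (¬_; yes; no)
open import Relation.Unary using (Pred; Decidable)
open import Relation.Unary.Properties using (∁?)

length-filter-∁ : ∀ {a p} {X : Set a} {P : Pred X p} (P? : Decidable P) (xs : List X) →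
  length xs ≡ length (filter P? xs) + length (filter (∁? P?) xs)
length-filter-∁ P? [] = refl
length-filter-∁ P? (x ∷ xs) with P? x
... | yes _ = cong suc (length-filter-∁ P? xs)
... | no _ = trans (cong suc (length-filter-∁ P? xs))
  (sym (+-suc (length (filter P? xs)) (length (filter (∁? P?) xs))))

length-filter-mono : ∀ {a p q} {X : Set a} {P : Pred X p} {Q : Pred X q}
  (P? : Decidable P) (Q? : Decidable Q) → (∀ {x} → P x → Q x) →
  (xs : List X) → length (filter P? xs) ≤ length (filter Q? xs)
length-filter-mono P? Q? P⇒Q xs = length-mono-≤ (filter⁺ P? Q? (λ { refl → P⇒Q }) (⊆-refl {x = xs}))

length-filter-disjoint : ∀ {a p q r} {X : Set a} {P : Pred X p} {Q : Pred X q} {R : Pred X r}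
  (P? : Decidable P) (Q? : Decidable Q) (R? : Decidable R) →
  (∀ {x} → P x → Q x → ⊥) → (∀ {x} → P x → R x) → (∀ {x} → Q x → R x) →
  (xs : List X) → length (filter P? xs) + length (filter Q? xs) ≤ length (filter R? xs)
length-filter-disjoint P? Q? R? disj P⇒R Q⇒R [] = z≤n
length-filter-disjoint P? Q? R? disj P⇒R Q⇒R (x ∷ xs)
  with ih ← length-filter-disjoint P? Q? R? disj P⇒R Q⇒R xs | P? x | Q? x | R? x
... | yes p | yes q | _     = ⊥-elim (disj p q)
... | yes p | no _  | no ¬r = ⊥-elim (¬r (P⇒R p))
... | no _  | yes q | no ¬r = ⊥-elim (¬r (Q⇒R q))
... | yes _ | no _  | yes _ = s≤s ih
... | no _  | yes _ | yes _ =
  subst (_≤ suc (length (filter R? xs))) (sym (+-suc (length (filter P? xs)) (length (filter Q? xs)))) (s≤s ih)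
... | no _  | no _  | yes _ = m≤n⇒m≤1+n ih
... | no _  | no _  | no _  = ih

⊆-++-split : ∀ {a} {X : Set a} (xs : List X) {ys w : List X} → w ⊆ xs ++ ys →
  ∃[ w₁ ] ∃[ w₂ ] (w ≡ w₁ ++ w₂ × w₁ ⊆ xs × w₂ ⊆ ys)
⊆-++-split [] {w = w} τ = [] , w , refl , [] , τ
⊆-++-split (x ∷ xs) (.x ∷ʳ τ) with ⊆-++-split xs τ
... | w₁ , w₂ , refl , τ₁ , τ₂ = w₁ , w₂ , refl , x ∷ʳ τ₁ , τ₂
⊆-++-split (x ∷ xs) (refl ∷ τ) with ⊆-++-split xs τ
... | w₁ , w₂ , refl , τ₁ , τ₂ = x ∷ w₁ , w₂ , refl , refl ∷ τ₁ , τ₂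

++-⊆-split : ∀ {a} {X : Set a} (xs : List X) {ys z : List X} → xs ++ ys ⊆ z →
  ∃[ z₁ ] ∃[ z₂ ] (z ≡ z₁ ++ z₂ × xs ⊆ z₁ × ys ⊆ z₂)
++-⊆-split [] {z = z} τ = [] , z , refl , [] , τ
++-⊆-split (x ∷ xs) (y ∷ʳ τ) with ++-⊆-split (x ∷ xs) τ
... | z₁ , z₂ , refl , τ₁ , τ₂ = y ∷ z₁ , z₂ , refl , y ∷ʳ τ₁ , τ₂
++-⊆-split (x ∷ xs) (refl ∷ τ) with ++-⊆-split xs τ
... | z₁ , z₂ , refl , τ₁ , τ₂ = x ∷ z₁ , z₂ , refl , refl ∷ τ₁ , τ₂

count : List ℕ → List ℕ → ℕ
count A w = length (filter (_∈? w) A)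

count-mono : ∀ A {w w′} → (∀ {x} → x ∈ w → x ∈ w′) → count A w ≤ count A w′
count-mono A {w} {w′} w⊆w′ = length-filter-mono (_∈? w) (_∈? w′) w⊆w′ A

count-disjoint : ∀ A x y → count A (filter (∁? (_∈? y)) x) + count A (filter (∁? (_∈? x)) y) ≤ count A (x ++ y)
count-disjoint A x y = length-filter-disjoint (_∈? _) (_∈? _) (_∈? (x ++ y)) disjoint
  (λ p → ∈-++⁺ˡ (proj₁ (∈-filter⁻ (∁? (_∈? y)) {xs = x} p)))
  (λ q → ∈-++⁺ʳ x (proj₁ (∈-filter⁻ (∁? (_∈? x)) {xs = y} q)))
  A
  where
  disjoint : ∀ {z} → z ∈ filter (∁? (_∈? y)) x → z ∈ filter (∁? (_∈? x)) y → ⊥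
  disjoint p q = proj₂ (∈-filter⁻ (∁? (_∈? y)) {xs = x} p) (proj₁ (∈-filter⁻ (∁? (_∈? x)) {xs = y} q))

count-filterˡ : ∀ A x y {p} {P : Pred ℕ p} (P? : Decidable P) → count A (filter P? x) ≤ count A (x ++ y)
count-filterˡ A x y P? = count-mono A (λ z∈ → ∈-++⁺ˡ (proj₁ (∈-filter⁻ P? {xs = x} z∈)))

count-filterʳ : ∀ A x y {p} {P : Pred ℕ p} (P? : Decidable P) → count A (filter P? y) ≤ count A (x ++ y)
count-filterʳ A x y P? = count-mono A (λ z∈ → ∈-++⁺ʳ x (proj₁ (∈-filter⁻ P? {xs = y} z∈)))

length-++-by-sharing : ∀ x y → length (x ++ y) ≡
  (length (filter (∁? (_∈? y)) x) + length (filter (∁? (_∈? x)) y)) +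
  (length (filter (_∈? y) x) + length (filter (_∈? x) y))
length-++-by-sharing x y = begin
  length (x ++ y)              ≡⟨ length-++ x ⟩
  length x + length y          ≡⟨ cong₂ _+_ (length-filter-∁ (_∈? y) x) (length-filter-∁ (_∈? x) y) ⟩
  (sx + px) + (sy + py)        ≡⟨ shuffle sx px sy py ⟩
  (px + py) + (sx + sy)        ∎
  where
  open ≡-Reasoning
  sx = length (filter (_∈? y) x)
  sy = length (filter (_∈? x) y)
  px = length (filter (∁? (_∈? y)) x)
  py = length (filter (∁? (_∈? x)) y)
  shuffle : ∀ a b c d → (a + b) + (c + d) ≡ (b + d) + (a + c)
  shuffle = solve-∀

-- A block W ⊆ A is a sublist of the letters of A that it uses, hence no longer than their number.
block≤count : ∀ {A W} → W ⊆ A → length W ≤ count A W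
block≤count {A} {W} W⊆A = length-mono-≤ (subst (_⊆ filter (_∈? W) A)
  (filter-all (_∈? W) (All.tabulate (λ x∈W → x∈W)))
  (filter⁺ (_∈? W) (_∈? W) (λ { refl x∈W → x∈W }) W⊆A))

data Blocks (A : List ℕ) : ℕ → List ℕ → Set where
  []  : Blocks A 0 []
  _∷_ : ∀ {K W w} → W ⊆ A → Blocks A K w → Blocks A (suc K) (W ++ w)

blocks-filter : ∀ {A K w} {p} {P : Pred ℕ p} (P? : Decidable P) → Blocks A K w → Blocks A K (filter P? w)
blocks-filter P? [] = []
blocks-filter P? (_∷_ {W = W} {w} W⊆A bs) =
  subst (Blocks _ _) (sym (filter-++ P? W w)) (⊆-trans (filter-⊆ P? W) W⊆A ∷ blocks-filter P? bs)

blocks-splitAt : ∀ {A K₂ w} K₁ → Blocks A (K₁ + K₂) w →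
  ∃[ x ] ∃[ y ] (w ≡ x ++ y × Blocks A K₁ x × Blocks A K₂ y)
blocks-splitAt {w = w} zero bs = [] , w , refl , [] , bs
blocks-splitAt (suc K₁) (_∷_ {W = W} W⊆A bs) with blocks-splitAt K₁ bs
... | x , y , refl , bx , by = W ++ x , y , sym (++-assoc W x y) , W⊆A ∷ bx , by

-- Each block uses every letter at most once: |w| ≤ K · (number of letters of w).
length-blocks : ∀ {A K w} → Blocks A K w → length w ≤ K * count A w
length-blocks [] = z≤n
length-blocks {A} {suc K} (_∷_ {W = W} {w} W⊆A bs) = begin
  length (W ++ w)             ≡⟨ length-++ W ⟩
  length W + length w         ≤⟨ +-mono-≤ (block≤count W⊆A) (length-blocks bs) ⟩
  count A W + K * count A w   ≤⟨ +-mono-≤ (count-mono A ∈-++⁺ˡ) (*-monoʳ-≤ K (count-mono A (∈-++⁺ʳ W))) ⟩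
  suc K * count A (W ++ w)    ∎
  where open ≤-Reasoning

blocks-of-powers : ∀ A K {w} → w ⊆ concat (replicate K A) → Blocks A K w
blocks-of-powers A zero [] = []
blocks-of-powers A (suc K) τ with ⊆-++-split A τ
... | W , w , refl , W⊆A , τ′ = W⊆A ∷ blocks-of-powers A K τ′

data Rounds (S : List ℕ) : ℕ → List ℕ → Set where
  []  : ∀ {w} → Rounds S 0 w
  _∷_ : ∀ {n u w} → All (_∈ u) S → Rounds S n w → Rounds S (suc n) (u ++ w)

Formation : ℕ → ℕ → List ℕ → Set
Formation N n w = ∃[ S ] (Unique S × length S ≡ N × Rounds S n w)

rounds-mono : ∀ {S n w w′} → w ⊆ w′ → Rounds S n w → Rounds S n w′
rounds-mono τ [] = []
rounds-mono τ (_∷_ {u = u} S⊆u rs) with ++-⊆-split u τ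
... | z₁ , z₂ , refl , τ₁ , τ₂ = All.map (lookup τ₁) S⊆u ∷ rounds-mono τ₂ rs

rounds-snoc : ∀ {S n w u} → Rounds S n w → All (_∈ u) S → Rounds S (suc n) (w ++ u)
rounds-snoc {S} {w = w} {u} [] S⊆u =
  subst (Rounds S 1) (++-identityʳ (w ++ u)) (All.map (∈-++⁺ʳ w) S⊆u ∷ [])
rounds-snoc {S} {u = u} (_∷_ {u = u₀} {w₀} S⊆u₀ rs) S⊆u =
  subst (Rounds S _) (sym (++-assoc u₀ w₀ u)) (S⊆u₀ ∷ rounds-snoc rs S⊆u)

rounds-letters : ∀ {S n w} → Rounds S (suc n) w → All (_∈ w) S
rounds-letters (S⊆u ∷ _) = All.map ∈-++⁺ˡ S⊆u

formation-mono : ∀ {N n w w′} → w ⊆ w′ → Formation N n w → Formation N n w′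
formation-mono τ (S , S! , |S| , rs) = S , S! , |S| , rounds-mono τ rs

formation-extendʳ : ∀ {N n} x y → Formation N (suc n) (filter (_∈? y) x) → Formation N (suc (suc n)) (x ++ y)
formation-extendʳ x y (S , S! , |S| , rs) = S , S! , |S| ,
  rounds-snoc (rounds-mono (filter-⊆ (_∈? y) x) rs)
              (All.map (λ s∈ → proj₂ (∈-filter⁻ (_∈? y) {xs = x} s∈)) (rounds-letters rs))

formation-extendˡ : ∀ {N n} x y → Formation N (suc n) (filter (_∈? x) y) → Formation N (suc (suc n)) (x ++ y)
formation-extendˡ x y (S , S! , |S| , rs) = S , S! , |S| ,
  All.map (λ s∈ → proj₂ (∈-filter⁻ (_∈? x) {xs = y} s∈)) (rounds-letters rs) ∷ rounds-mono (filter-⊆ (_∈? x) y) rs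

indexOf : ℕ → List ℕ → ℕ
indexOf x [] = 0
indexOf x (y ∷ ys) with x ≟ y
... | yes _ = 0
... | no _ = suc (indexOf x ys)

-- at xs i: the i-th entry of xs (0 past the end).
at : List ℕ → ℕ → ℕ
at [] _ = 0
at (x ∷ xs) zero = x
at (x ∷ xs) (suc i) = at xs i

indexOf< : ∀ {x xs} → x ∈ xs → indexOf x xs < length xs
indexOf< {x} {y ∷ ys} x∈ with x ≟ y
... | yes _ = s≤s z≤n
indexOf< {x} {y ∷ ys} (here x≡y) | no x≢y = ⊥-elim (x≢y x≡y)
indexOf< {x} {y ∷ ys} (there x∈) | no _ = s≤s (indexOf< x∈)

at-indexOf : ∀ {x xs} → x ∈ xs → at xs (indexOf x xs) ≡ x
at-indexOf {x} {y ∷ ys} x∈ with x ≟ y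
... | yes x≡y = sym x≡y
at-indexOf {x} {y ∷ ys} (here x≡y) | no x≢y = ⊥-elim (x≢y x≡y)
at-indexOf {x} {y ∷ ys} (there x∈) | no _ = at-indexOf x∈

at∈ : ∀ {xs i} → i < length xs → at xs i ∈ xs
at∈ {x ∷ xs} {zero} _ = here refl
at∈ {x ∷ xs} {suc i} (s≤s i<) = there (at∈ i<)

indexOf-at : ∀ {xs i} → Unique xs → i < length xs → indexOf (at xs i) xs ≡ i
indexOf-at {y ∷ ys} {zero} _ _ with y ≟ y
... | yes _ = refl
... | no y≢y = ⊥-elim (y≢y refl)
indexOf-at {y ∷ ys} {suc i} (y≢ys ∷ ys!) (s≤s i<) with at ys i ≟ y
... | yes eq = ⊥-elim (All.lookup y≢ys (at∈ i<) (sym eq))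
... | no _ = cong suc (indexOf-at ys! i<)

-- A word p over S embeds into any sequence with |p| rounds of S: letter i in round i.
rounds-embed : ∀ {S w} (p : List ℕ) → All (_∈ S) p → Rounds S (length p) w → p ⊆ w
rounds-embed {w = w} [] _ _ = minimum w
rounds-embed (x ∷ p) (x∈S ∷ p⊆S) (S⊆u ∷ rs) = ++⁺ (from∈ (All.lookup S⊆u x∈S)) (rounds-embed p p⊆S rs)

-- Renaming the letters of v into |v| distinct letters S: a letter first occurring at position i
-- of v goes to the i-th letter of S, and back.  This is an isomorphism from map rename v onto v.
module Renaming (v S : List ℕ) (S! : Unique S) (|S|≡|v| : length S ≡ length v) where

  rename unrename : ℕ → ℕ
  rename x = at S (indexOf x v)
  unrename y = at v (indexOf y S)

  indexOf<|S| : ∀ {x} → x ∈ v → indexOf x v < length S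
  indexOf<|S| x∈v = subst (_ <_) (sym |S|≡|v|) (indexOf< x∈v)

  rename∈S : ∀ {x} → x ∈ v → rename x ∈ S
  rename∈S x∈v = at∈ (indexOf<|S| x∈v)

  unrename-rename : ∀ {x} → x ∈ v → unrename (rename x) ≡ x
  unrename-rename x∈v = trans (cong (at v) (indexOf-at S! (indexOf<|S| x∈v))) (at-indexOf x∈v)

  renamed-iso : Isomorphic (map rename v) v
  renamed-iso = unrename , unrename∘rename , injective
    where
    unrename∘rename : map unrename (map rename v) ≡ v
    unrename∘rename = trans (sym (map-∘ v)) (map-id-local (All.tabulate unrename-rename))
    injective : ∀ x y → x ∈ map rename v → y ∈ map rename v → unrename x ≡ unrename y → x ≡ y
    injective x y x∈ y∈ eq with ∈-map⁻ rename x∈ | ∈-map⁻ rename y∈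
    ... | a , a∈v , refl | b , b∈v , refl =
      cong rename (trans (sym (unrename-rename a∈v)) (trans eq (unrename-rename b∈v)))

formation⇒¬free : ∀ v {w} → Formation (length v) (length v) w → ¬ Free w v
formation⇒¬free v {w} (S , S! , |S| , rs) free = free (map rename v , embedding , renamed-iso)
  where
  open Renaming v S S! |S|
  embedding : map rename v ⊆ w
  embedding = rounds-embed (map rename v) (All.map⁺ (All.tabulate rename∈S))
    (subst (λ n → Rounds S n w) (sym (length-map rename v)) rs)

halve : ∀ h {K} → K ≤ 2 ^ suc h → ∃[ K₁ ] ∃[ K₂ ] (K ≡ K₁ + K₂ × K₁ ≤ 2 ^ h × K₂ ≤ 2 ^ h)
halve h {K} K≤ with K ≤? 2 ^ h
... | yes K≤half = K , 0 , sym (+-identityʳ K) , K≤half , z≤n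
... | no K≰half = 2 ^ h , K ∸ 2 ^ h , sym (m+[n∸m]≡n (<⇒≤ (≰⇒> K≰half))) , ≤-refl ,
  ≤-trans (∸-monoˡ-≤ (2 ^ h) K≤) (≤-reflexive (trans (cong (λ t → 2 ^ h + t ∸ 2 ^ h) (+-identityʳ (2 ^ h)))
                                                   (m+n∸m≡n (2 ^ h) (2 ^ h))))

-- The constant of the formation lemma: c N n = 2^n (N+1).
c : ℕ → ℕ → ℕ
c N zero = suc N
c N (suc n) = 2 * c N n

c-positive : ∀ N n → 1 ≤ c N n
c-positive N zero = s≤s z≤n
c-positive N (suc n) = ≤-trans (c-positive N n) (m≤m+n (c N n) _)

+-bound : ∀ α β s₁ s₂ t₁ t₂ {x y} → x ≤ α * (s₁ + t₁) * β → y ≤ α * (s₂ + t₂) * β →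
  x + y ≤ α * ((s₁ + s₂) + (t₁ + t₂)) * β
+-bound α β s₁ s₂ t₁ t₂ x≤ y≤ = ≤-trans (+-mono-≤ x≤ y≤) (≤-reflexive (distrib α β s₁ s₂ t₁ t₂))
  where
  distrib : ∀ α β s₁ s₂ t₁ t₂ → α * (s₁ + t₁) * β + α * (s₂ + t₂) * β ≡ α * ((s₁ + s₂) + (t₁ + t₂)) * β
  distrib = solve-∀

-- The arithmetic of the doubling step: letters private to one half (counts r₁, r₂) are
-- paid for at level (n,h), shared letters (counts r₃, r₄ ≤ r) at level (n-1,h) with half the
-- constant and one factor q less; the two contributions add up to the factor q·p + p = (q+1)·p.
doubling-arith : ∀ a q p r r₁ r₂ r₃ r₄ K₁ K₂ {ℓ₁ ℓ₂ ℓ₃ ℓ₄} →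
  r₁ + r₂ ≤ r → r₃ ≤ r → r₄ ≤ r →
  ℓ₁ ≤ 2 * a * (r₁ + K₁) * (q * p) → ℓ₂ ≤ 2 * a * (r₂ + K₂) * (q * p) →
  ℓ₃ ≤ a * (r₃ + K₁) * p → ℓ₄ ≤ a * (r₄ + K₂) * p →
  (ℓ₁ + ℓ₂) + (ℓ₃ + ℓ₄) ≤ 2 * a * (r + (K₁ + K₂)) * (suc q * p)
doubling-arith a q p r r₁ r₂ r₃ r₄ K₁ K₂ {ℓ₁} {ℓ₂} {ℓ₃} {ℓ₄} r₁₂≤ r₃≤ r₄≤ ℓ₁≤ ℓ₂≤ ℓ₃≤ ℓ₄≤ = begin
  (ℓ₁ + ℓ₂) + (ℓ₃ + ℓ₄)
    ≤⟨ +-mono-≤ (+-bound (2 * a) (q * p) r₁ r₂ K₁ K₂ ℓ₁≤ ℓ₂≤) (+-bound a p r₃ r₄ K₁ K₂ ℓ₃≤ ℓ₄≤) ⟩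
  2 * a * ((r₁ + r₂) + K) * (q * p) + a * ((r₃ + r₄) + K) * p
    ≤⟨ +-mono-≤ (*-monoˡ-≤ (q * p) (*-monoʳ-≤ (2 * a) (+-monoˡ-≤ K r₁₂≤)))
                (*-monoˡ-≤ p (*-monoʳ-≤ a (≤-trans (+-monoˡ-≤ K (+-mono-≤ r₃≤ r₄≤)) double))) ⟩
  2 * a * (r + K) * (q * p) + a * (2 * (r + K)) * p
    ≡⟨ collect a q p (r + K) ⟩
  2 * a * (r + K) * (suc q * p) ∎
  where
  open ≤-Reasoning
  K = K₁ + K₂
  double : (r + r) + K ≤ 2 * (r + K)
  double = ≤-trans (m≤m+n ((r + r) + K) K) (≤-reflexive (doubled r K))
    where
    doubled : ∀ r K → (r + r) + K + K ≡ 2 * (r + K)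
    doubled = solve-∀
  collect : ∀ a q p X → 2 * a * X * (q * p) + a * (2 * X) * p ≡ 2 * a * X * (suc q * p)
  collect = solve-∀

module FormationLemma (N : ℕ) {A : List ℕ} (A! : Unique A) where

  Bound : ℕ → ℕ → Set
  Bound n h = ∀ {K w} → Blocks A K w → K ≤ 2 ^ h → ¬ Formation N n w →
              length w ≤ c N n * (count A w + K) * suc h ^ n

  bound-zero : ∀ h → Bound 0 h
  bound-zero h _ _ noF = ⊥-elim (noF (downFrom N , downFrom⁺ N , length-downFrom N , []))

  -- With no (N,1)-formation, w uses fewer than N letters, and each block uses each at most once.
  bound-one : ∀ h → Bound 1 h
  bound-one h {K} {w} bs _ noF with N ≤? count A w
  ... | yes N≤r = ⊥-elim (noF (S , take⁺ N (unique-filter⁺ (_∈? w) A!) , |S| ,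
                               subst (Rounds S 1) (++-identityʳ w) (S⊆w ∷ [])))
    where
    S = take N (filter (_∈? w) A)
    |S| : length S ≡ N
    |S| = trans (length-take N (filter (_∈? w) A)) (m≤n⇒m⊓n≡m N≤r)
    S⊆w : All (_∈ w) S
    S⊆w = All.tabulate (λ s∈S → proj₂ (∈-filter⁻ (_∈? w) {xs = A} (lookup (take-⊆ N _) s∈S)))
  ... | no N≰r = begin
    length w                     ≤⟨ length-blocks bs ⟩
    K * r                        ≤⟨ *-monoʳ-≤ K (<⇒≤ (≰⇒> N≰r)) ⟩
    K * N                        ≤⟨ *-monoˡ-≤ N (m≤n+m K r) ⟩
    (r + K) * N                  ≡⟨ *-comm (r + K) N ⟩
    N * (r + K)                  ≤⟨ *-monoˡ-≤ (r + K) (≤-trans (n≤1+n N) (m≤m+n (suc N) _)) ⟩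
    c N 1 * (r + K)              ≡⟨ sym (*-identityʳ _) ⟩
    c N 1 * (r + K) * 1          ≤⟨ *-monoʳ-≤ (c N 1 * (r + K)) (m^n>0 (suc h) 1) ⟩
    c N 1 * (r + K) * suc h ^ 1  ∎
    where
    open ≤-Reasoning
    r = count A w

  -- A single block uses each of its letters once.
  bound-oneBlock : ∀ n → Bound n 0
  bound-oneBlock n {K} {w} bs K≤1 _ = begin
    length w                   ≤⟨ length-blocks bs ⟩
    K * r                      ≤⟨ *-monoˡ-≤ r K≤1 ⟩
    1 * r                      ≡⟨ *-identityˡ r ⟩
    r                          ≤⟨ m≤m+n r K ⟩
    r + K                      ≡⟨ sym (*-identityˡ (r + K)) ⟩
    1 * (r + K)                ≤⟨ *-monoˡ-≤ (r + K) (c-positive N n) ⟩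
    c N n * (r + K)            ≡⟨ sym (*-identityʳ _) ⟩
    c N n * (r + K) * 1        ≡⟨ cong (c N n * (r + K) *_) (sym (^-zeroˡ n)) ⟩
    c N n * (r + K) * 1 ^ n    ∎
    where
    open ≤-Reasoning
    r = count A w

  -- Letters shared by both halves are handled at level (n+1,h):
  -- a formation among the shared letters of x gains one round from y (and symmetrically).
  step : ∀ {n h} → Bound (2 + n) h → Bound (1 + n) h → Bound (2 + n) (suc h)
  step {n} {h} IH IH′ bs K≤ noF with halve h K≤
  ... | K₁ , K₂ , refl , K₁≤ , K₂≤ with blocks-splitAt K₁ bs
  ... | x , y , refl , bx , by = begin
    length (x ++ y)
      ≡⟨ length-++-by-sharing x y ⟩
    (length x∖y + length y∖x) + (length x∩y + length y∩x)
      ≤⟨ doubling-arith (c N (suc n)) (suc h) (suc h ^ suc n) r _ _ _ _ K₁ K₂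
           (count-disjoint A x y) (count-filterˡ A x y (_∈? y)) (count-filterʳ A x y (_∈? x))
           (IH (blocks-filter (∁? (_∈? y)) bx) K₁≤ (noF ∘ formation-mono (++⁺ʳ y (filter-⊆ _ x))))
           (IH (blocks-filter (∁? (_∈? x)) by) K₂≤ (noF ∘ formation-mono (++⁺ˡ x (filter-⊆ _ y))))
           (IH′ (blocks-filter (_∈? y) bx) K₁≤ (noF ∘ formation-extendʳ x y))
           (IH′ (blocks-filter (_∈? x) by) K₂≤ (noF ∘ formation-extendˡ x y)) ⟩
    c N (2 + n) * (r + (K₁ + K₂)) * (suc (suc h) * suc h ^ suc n)
      ≤⟨ *-monoʳ-≤ (c N (2 + n) * (r + (K₁ + K₂))) (*-monoʳ-≤ (suc (suc h)) (^-monoˡ-≤ (suc n) (n≤1+n (suc h)))) ⟩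
    c N (2 + n) * (r + (K₁ + K₂)) * suc (suc h) ^ (2 + n) ∎
    where
    open ≤-Reasoning
    r = count A (x ++ y)
    x∖y = filter (∁? (_∈? y)) x
    y∖x = filter (∁? (_∈? x)) y
    x∩y = filter (_∈? y) x
    y∩x = filter (_∈? x) y

  bound : ∀ n h → Bound n h
  bound zero h = bound-zero h
  bound (suc zero) h = bound-one h
  bound (suc (suc n)) zero = bound-oneBlock (suc (suc n))
  bound (suc (suc n)) (suc h) = step (bound (suc (suc n)) h) (bound (suc n) h)

length-concat-replicate : ∀ K (xs : List ℕ) → length (concat (replicate K xs)) ≡ K * length xs
length-concat-replicate zero xs = refl
length-concat-replicate (suc K) xs = trans (length-++ xs) (cong (length xs +_) (length-concat-replicate K xs))

-- A v-free subsequence has no (|v|,|v|)-formation and is a k-block sequence using at most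
-- k letters, so the formation lemma bounds its length.
ss-bound : ∀ v j m → m ≤ 2 ^ j * 2 ^ j →
  ss≤ m v (c (length v) (length v) * (2 ^ j + 2 ^ j) * suc j ^ length v)
ss-bound v j m m≤k² = u , |u| , lss
  where
  N = length v
  k = 2 ^ j
  A = downFrom k
  open FormationLemma N (downFrom⁺ k)
  u = take m (concat (replicate k A))
  |u| : length u ≡ m
  |u| = trans (length-take m _) (m≤n⇒m⊓n≡m (subst (m ≤_)
          (sym (trans (length-concat-replicate k A) (cong (k *_) (length-downFrom k)))) m≤k²))
  lss : LSS≤ u v (c N N * (k + k) * suc j ^ N)
  lss w w⊆u free = begin
    length w                        ≤⟨ bound N j (blocks-of-powers A k (⊆-trans w⊆u (take-⊆ m _))) ≤-refl
                                              (λ F → formation⇒¬free v F free) ⟩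
    c N N * (count A w + k) * suc j ^ N
      ≤⟨ *-monoˡ-≤ (suc j ^ N) (*-monoʳ-≤ (c N N) (+-monoˡ-≤ k (≤-trans (length-filter (_∈? w) A) (≤-reflexive (length-downFrom k))))) ⟩
    c N N * (k + k) * suc j ^ N     ∎
    where open ≤-Reasoning

square-cover : ∀ m → ∃[ j ] (suc m ≤ 2 ^ j * 2 ^ j × 2 ^ j * 2 ^ j ≤ 4 * suc m)
square-cover zero = 0 , ≤-refl , s≤s z≤n
square-cover (suc m) with square-cover m
... | j , lo , hi with suc (suc m) ≤? 2 ^ j * 2 ^ j
... | yes lo′ = j , lo′ , ≤-trans hi (*-monoʳ-≤ 4 (n≤1+n (suc m)))
... | no ¬lo′ = suc j , subst (suc (suc m) ≤_) (sym quadrupled) m+2≤4m+4 ,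
                        subst (_≤ 4 * suc (suc m)) (sym quadrupled) (*-monoʳ-≤ 4 (n≤1+n (suc m)))
  where
  -- here 4^j = m + 1 exactly, so 4^(j+1) = 4(m + 1)
  quadrupled : 2 ^ suc j * 2 ^ suc j ≡ 4 * suc m
  quadrupled = trans (square-double (2 ^ j)) (cong (4 *_) (≤-antisym (≤-pred (≰⇒> ¬lo′)) lo))
    where
    square-double : ∀ X → (2 * X) * (2 * X) ≡ 4 * (X * X)
    square-double = solve-∀
  m+2≤4m+4 : suc (suc m) ≤ 4 * suc m
  m+2≤4m+4 = subst (suc (suc m) ≤_) (expand m) (m≤m+n (suc (suc m)) (3 * m + 2))
    where
    expand : ∀ m → suc (suc m) + (3 * m + 2) ≡ 4 * suc m
    expand = solve-∀

-- If m ≥ 17 and 4^j ≤ 4m ≤ 4·4^j then j ≥ 3, so j + 1 ≤ 2(j - 1) ≤ ⌊log₂ m⌋.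
exponent≤log : ∀ {m} j → 17 ≤ m → m ≤ 2 ^ j * 2 ^ j → 2 ^ j * 2 ^ j ≤ 4 * m → suc j ≤ ⌊log₂ m ⌋
exponent≤log 0 17≤m m≤1 _ = ⊥-elim (1+n≰n (≤-trans 17≤m (≤-trans m≤1 (s≤s z≤n))))
exponent≤log 1 17≤m m≤4 _ = ⊥-elim (1+n≰n (≤-trans 17≤m (≤-trans m≤4 (m≤m+n 4 12))))
exponent≤log 2 17≤m m≤16 _ = ⊥-elim (1+n≰n (≤-trans 17≤m m≤16))
exponent≤log {m} (suc (suc (suc i))) _ _ 4^j≤4m = begin
  4 + i                       ≤⟨ s≤s (s≤s (m≤n+m (2 + i) i)) ⟩
  (2 + i) + (2 + i)           ≡⟨ sym (⌊log₂[2^n]⌋≡n ((2 + i) + (2 + i))) ⟩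
  ⌊log₂ 2 ^ ((2 + i) + (2 + i)) ⌋ ≤⟨ ⌊log₂⌋-mono-≤ 4^[j-1]≤m ⟩
  ⌊log₂ m ⌋                   ∎
  where
  open ≤-Reasoning
  square-double : ∀ X → (2 * X) * (2 * X) ≡ 4 * (X * X)
  square-double = solve-∀
  4^[j-1]≤m : 2 ^ ((2 + i) + (2 + i)) ≤ m
  4^[j-1]≤m = subst (_≤ m) (sym (^-distribˡ-+-* 2 (2 + i) (2 + i)))
               (*-cancelˡ-≤ 4 (subst (_≤ 4 * m) (square-double (2 ^ (2 + i))) 4^j≤4m))

square-bound : ∀ a k m s L N → s ≤ L → k * k ≤ 4 * m →
  (a * (k + k) * s ^ N) * (a * (k + k) * s ^ N) ≤ 16 * (a * a) * m * L ^ (N + N)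
square-bound a k m s L N s≤L k²≤4m = begin
  (a * (k + k) * s ^ N) * (a * (k + k) * s ^ N)  ≤⟨ *-mono-≤ B≤ B≤ ⟩
  (a * (k + k) * L ^ N) * (a * (k + k) * L ^ N)  ≡⟨ expand a k (L ^ N) ⟩
  4 * (a * a) * (k * k) * (L ^ N * L ^ N)         ≤⟨ *-monoˡ-≤ (L ^ N * L ^ N) (*-monoʳ-≤ (4 * (a * a)) k²≤4m) ⟩
  4 * (a * a) * (4 * m) * (L ^ N * L ^ N)         ≡⟨ regroup a m (L ^ N * L ^ N) ⟩
  16 * (a * a) * m * (L ^ N * L ^ N)              ≡⟨ cong (16 * (a * a) * m *_) (sym (^-distribˡ-+-* L N N)) ⟩
  16 * (a * a) * m * L ^ (N + N)                  ∎
  where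
  open ≤-Reasoning
  B≤ : a * (k + k) * s ^ N ≤ a * (k + k) * L ^ N
  B≤ = *-monoʳ-≤ (a * (k + k)) (^-monoˡ-≤ N s≤L)
  expand : ∀ a k p → (a * (k + k) * p) * (a * (k + k) * p) ≡ 4 * (a * a) * (k * k) * (p * p)
  expand = solve-∀
  regroup : ∀ a m q → 4 * (a * a) * (4 * m) * q ≡ 16 * (a * a) * m * q
  regroup = solve-∀

mainTheorem2 : (v : Seq) → ∃[ t ] ∃[ C ] ∃[ M ] (∀ m → M ≤ m →
                 ∃[ B ] (ss≤ m v B × B * B ≤ C * m * ⌊log₂ m ⌋ ^ t))
mainTheorem2 v = N + N , 16 * (c N N * c N N) , 17 , bounded
  where
  N = length v
  bounded : ∀ m → 17 ≤ m → ∃[ B ] (ss≤ m v B × B * B ≤ 16 * (c N N * c N N) * m * ⌊log₂ m ⌋ ^ (N + N))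
  bounded (suc m) 17≤m with square-cover m
  ... | j , m≤4^j , 4^j≤4m = c N N * (2 ^ j + 2 ^ j) * suc j ^ N ,
    ss-bound v j (suc m) m≤4^j ,
    square-bound (c N N) (2 ^ j) (suc m) (suc j) ⌊log₂ suc m ⌋ N (exponent≤log j 17≤m m≤4^j 4^j≤4m) 4^j≤4m
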